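{- Let $\Delta$ be an odd positive integer and let $T_v$ be a $\Delta$-semiregular rooted tree of height two with root $v$. Let $c$ be any star edge coloring of $T_v$ with color set $\mathcal{C}=\{1,\ldots,\left\lfloor\frac{3\Delta}{2}\right\rfloor\}$. Then for every two neighbours $x$ and $y$ of $v$: (a) $|C(x)\cap C(y)|\geq \frac{\Delta+1}{2}$, and $\mathcal{C}\setminus C(v)\subset C(x)$; (b) every color of $C(v)$ is used on exactly $\frac{\Delta-1}{2}$ edges that are not incident to $v$; (c) $c(vx)\in C(y)$ or $c(vy)\in C(x)$.
   Context: A star edge coloring of a graph is a proper edge coloring such that no path or cycle of length four (i.e. with four edges) is bi-colored. A graph is $\Delta$-semiregular if every vertex that is not a leaf has degree exactly $\Delta$. The height of a rooted tree is the length of a longest path from the root to a leaf. For an edge coloring $c$, $c(e)$ denotes the color of edge $e$ and $C(u)$ denotes the set of colors of all edges incident to vertex $u$. -}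

module Defs where

open import Data.Nat using (ℕ; _∸_)
open import Data.Fin using (Fin)
open import Data.Product using (Σ; ∃; _×_; _,_)
open import Data.Sum using (_⊎_)
open import Data.List using (List; []; _∷_)
open import Data.List.Relation.Unary.Unique.Propositional using (Unique)
open import Relation.Binary.PropositionalEquality using (_≡_; _≢_)
open import Relation.Nullary using (¬_)
open import Function.Definitions using (Injective)

record Graph : Set₁ where
  field
    V    : Set
    E    : Set
    end₁ : E → V
    end₂ : E → V

module _ (G : Graph) where
  open Graph G

  Incident : V → E → Set
  Incident u e = end₁ e ≡ u ⊎ end₂ e ≡ u

  Joins : E → V → V → Set
  Joins e a b = (end₁ e ≡ a × end₂ e ≡ b) ⊎ (end₁ e ≡ b × end₂ e ≡ a)

  Adjacent : V → V → Set
  Adjacent a b = ∃ λ e → Joins e a b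

  IsProperEdgeColoring : {Col : Set} → (E → Col) → Set
  IsProperEdgeColoring c =
    ∀ (u : V) (e e′ : E) → e ≢ e′ → Incident u e → Incident u e′ → c e ≢ c e′

  _∈C_ : {Col : Set} → {c : E → Col} → Col → V → Set
  _∈C_ {c = c} col u = ∃ λ e → Incident u e × c e ≡ col

  record Walk4 : Set where
    field
      v₀ v₁ v₂ v₃ v₄ : V
      e₁ e₂ e₃ e₄ : E
      j₁ : Joins e₁ v₀ v₁
      j₂ : Joins e₂ v₁ v₂
      j₃ : Joins e₃ v₂ v₃
      j₄ : Joins e₄ v₃ v₄

  IsPath4 : Walk4 → Set
  IsPath4 w = Unique (v₀ ∷ v₁ ∷ v₂ ∷ v₃ ∷ v₄ ∷ [])
    where open Walk4 w

  IsCycle4 : Walk4 → Set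
  IsCycle4 w = v₀ ≡ v₄ × Unique (v₀ ∷ v₁ ∷ v₂ ∷ v₃ ∷ [])
    where open Walk4 w

  BiColored : {Col : Set} → (E → Col) → Walk4 → Set
  BiColored {Col} c w =
    Σ Col λ a → Σ Col λ b →
      (c e₁ ≡ a ⊎ c e₁ ≡ b) × (c e₂ ≡ a ⊎ c e₂ ≡ b) ×
      (c e₃ ≡ a ⊎ c e₃ ≡ b) × (c e₄ ≡ a ⊎ c e₄ ≡ b)
    where open Walk4 w

  IsStarEdgeColoring : {Col : Set} → (E → Col) → Set
  IsStarEdgeColoring c =
    IsProperEdgeColoring c ×
    (∀ (w : Walk4) → (IsPath4 w ⊎ IsCycle4 w) → ¬ BiColored c w)

AtLeast : {A : Set} → ℕ → (A → Set) → Set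
AtLeast {A} k P =
  Σ (Fin k → A) λ f → Injective _≡_ _≡_ f × (∀ i → P (f i))

Exactly : {A : Set} → ℕ → (A → Set) → Set
Exactly {A} k P =
  Σ (Fin k → A) λ f → Injective _≡_ _≡_ f × (∀ i → P (f i)) ×
    (∀ a → P a → ∃ λ i → f i ≡ a)

-- The Δ-semiregular rooted tree of height two with root v:
-- root v has Δ children x_i, each x_i has Δ - 1 leaf children.

data TVtx (Δ : ℕ) : Set where
  root : TVtx Δ
  mid  : Fin Δ → TVtx Δ
  leaf : Fin Δ → Fin (Δ ∸ 1) → TVtx Δ

data TEdge (Δ : ℕ) : Set where
  top : Fin Δ → TEdge Δ
  bot : Fin Δ → Fin (Δ ∸ 1) → TEdge Δ

tEnd₁ : ∀ {Δ} → TEdge Δ → TVtx Δ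
tEnd₁ (top i)   = root
tEnd₁ (bot i j) = mid i

tEnd₂ : ∀ {Δ} → TEdge Δ → TVtx Δ
tEnd₂ (top i)   = mid i
tEnd₂ (bot i j) = leaf i j

T : ℕ → Graph
T Δ = record { V = TVtx Δ ; E = TEdge Δ ; end₁ = tEnd₁ ; end₂ = tEnd₂ }

{-
Write Δ = 2m + 1 and let v x₀, …, v x_{2m} be the root edges, so each x_i carries 2m pendant
edges and Δ + m colours are available. Say i ⇝ j when c(v x_j) reappears on a pendant edge at x_i.
Only m colours avoid C(v), so at least m pendant colours at x_i are root colours, i.e. every
out-degree of ⇝ is at least m. A bicoloured path leaf–x_i–v–x_j–leaf is forbidden, so ⇝ is
asymmetric. An asymmetric relation on 2m + 1 points with all out-degrees at least m uses up all
(2m + 1)m unordered pairs, so it is a regular tournament: this gives (c), in-degrees m give (b),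
and out-degrees m leave room at every x_i for all m non-root colours, which with the root colour
of the arc between x and y gives the m + 1 common colours of (a).
-}

module Submission where

open import Defs
open import Data.Nat using (ℕ; _+_; _*_; _∸_; _<_; _/_; _%_)
open import Data.Fin using (Fin)
open import Data.Product using (_×_)
open import Data.Sum using (_⊎_)
open import Relation.Binary.PropositionalEquality using (_≡_; _≢_)
open import Relation.Nullary using (¬_)

open import Data.Bool using (if_then_else_)
open import Data.Empty using (⊥)
open import Data.Fin using (zero; suc; _≟_)
open import Data.Fin.Properties using (any?; suc-injective; 0≢1+n)
open import Data.List.Relation.Unary.All using ([]; _∷_)
open import Data.List.Relation.Unary.AllPairs using ([]; _∷_)
open import Data.Nat using (zero; suc; _≤_; z≤n)
open import Data.Nat.DivMod using (m≡m%n+[m/n]*n; m*n/n≡m; m*n%n≡0; +-distrib-/)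
import Data.Nat.Properties as ℕ
open import Data.Nat.Properties
  using ( +-0-commutativeMonoid; ≤-refl; ≤-reflexive; ≤-trans; ≤-antisym; ≮⇒≥; <⇒≱
        ; +-mono-≤; +-monoˡ-≤; +-monoʳ-≤; +-mono-<; +-cancelˡ-≤; +-cancelʳ-≤; +-cancelˡ-≡
        ; +-comm; +-suc; +-identityʳ; *-comm; *-identityʳ; *-distribˡ-+; module ≤-Reasoning )
open import Algebra.Properties.CommutativeMonoid.Sum +-0-commutativeMonoid
  using (sum; sum-cong-≗; ∑-comm; ∑-distrib-+)
open import Data.Nat.Tactic.RingSolver using (solve-∀)
open import Data.Product using (Σ; ∃; _,_; proj₁; proj₂)
open import Data.Sum using (inj₁; inj₂)
open import Data.Vec.Functional using (Vector)
open import Function using (_∘_)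
open import Function.Definitions using (Injective)
open import Relation.Binary.PropositionalEquality
  using (refl; cong; cong₂; sym; trans; subst; module ≡-Reasoning)
open import Relation.Nullary using (Dec; does; yes; no; contradiction)
open import Relation.Nullary.Decidable using (_⊎-dec_; _×-dec_; ¬?; decidable-stable)

sum-const : ∀ n x → sum {n} (λ _ → x) ≡ n * x
sum-const zero    x = refl
sum-const (suc n) x = cong (x +_) (sum-const n x)

sum-mono-≤ : ∀ {n} {f g : Vector ℕ n} → (∀ i → f i ≤ g i) → sum f ≤ sum g
sum-mono-≤ {zero}  f≤g = z≤n
sum-mono-≤ {suc n} f≤g = +-mono-≤ (f≤g zero) (sum-mono-≤ (f≤g ∘ suc))

+-mono-≤-tight : ∀ {a b c d} → a ≤ b → c ≤ d → b + d ≤ a + c → b ≤ a × d ≤ c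
+-mono-≤-tight {a} {b} {c} {d} a≤b c≤d b+d≤a+c =
  +-cancelʳ-≤ d b a (≤-trans b+d≤a+c (+-monoʳ-≤ a c≤d)) ,
  +-cancelˡ-≤ b d c (≤-trans b+d≤a+c (+-monoˡ-≤ c a≤b))

sum-mono-≤-tight : ∀ {n} {f g : Vector ℕ n} →
                   (∀ i → f i ≤ g i) → sum g ≤ sum f → ∀ i → f i ≡ g i
sum-mono-≤-tight {suc n} f≤g Σg≤Σf i
  with g₀≤f₀ , Σg′≤Σf′ ← +-mono-≤-tight (f≤g zero) (sum-mono-≤ (f≤g ∘ suc)) Σg≤Σf
  with i
... | zero  = ≤-antisym (f≤g zero) g₀≤f₀
... | suc i = sum-mono-≤-tight (f≤g ∘ suc) Σg′≤Σf′ i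

+-cancel-double-≤ : ∀ {a b} → a + a ≤ b + b → a ≤ b
+-cancel-double-≤ a+a≤b+b = ≮⇒≥ (λ b<a → <⇒≱ (+-mono-< b<a b<a) a+a≤b+b)

-- Defined through `does` alone, so that it computes on `any?`, `_⊎-dec_` and `¬?`.
𝟙 : {P : Set} → Dec P → ℕ
𝟙 p = if does p then 1 else 0

module _ {P Q : Set} where

  𝟙-mono : (p : Dec P) (q : Dec Q) → (P → Q) → 𝟙 p ≤ 𝟙 q
  𝟙-mono (yes p) (yes _) _   = ≤-refl
  𝟙-mono (yes p) (no ¬q) P⇒Q = contradiction (P⇒Q p) ¬q
  𝟙-mono (no _)  _       _   = z≤n

  𝟙-reflects : (p : Dec P) (q : Dec Q) → 𝟙 q ≤ 𝟙 p → Q → P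
  𝟙-reflects (yes p) _       _  _ = p
  𝟙-reflects (no _)  (yes _) () _
  𝟙-reflects (no _)  (no ¬q) _  q = contradiction q ¬q

  𝟙-⊎ : (p : Dec P) (q : Dec Q) → (P → ¬ Q) → 𝟙 (p ⊎-dec q) ≡ 𝟙 p + 𝟙 q
  𝟙-⊎ (yes p) (yes q) P⇒¬Q = contradiction q (P⇒¬Q p)
  𝟙-⊎ (yes _) (no _)  _    = refl
  𝟙-⊎ (no _)  (yes _) _    = refl
  𝟙-⊎ (no _)  (no _)  _    = refl

𝟙-¬ : {P : Set} (p : Dec P) → 𝟙 p + 𝟙 (¬? p) ≡ 1
𝟙-¬ (yes _) = refl
𝟙-¬ (no _)  = refl

𝟙-yes : {P : Set} (p : Dec P) → P → 𝟙 p ≡ 1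
𝟙-yes (yes _) _ = refl
𝟙-yes (no ¬p) p = contradiction p ¬p

count : ∀ {n} {P : Fin n → Set} → (∀ i → Dec (P i)) → ℕ
count P? = sum (λ i → 𝟙 (P? i))

module _ {n : ℕ} {P Q : Fin n → Set} (P? : ∀ i → Dec (P i)) (Q? : ∀ i → Dec (Q i)) where

  count-mono : (∀ i → P i → Q i) → count P? ≤ count Q?
  count-mono P⊆Q = sum-mono-≤ (λ i → 𝟙-mono (P? i) (Q? i) (P⊆Q i))

  count-mono-tight : (∀ i → P i → Q i) → count Q? ≤ count P? → ∀ i → Q i → P i
  count-mono-tight P⊆Q #Q≤#P i = 𝟙-reflects (P? i) (Q? i) (≤-reflexive (sym
    (sum-mono-≤-tight (λ i → 𝟙-mono (P? i) (Q? i) (P⊆Q i)) #Q≤#P i)))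

  count-⊎ : (∀ i → P i → ¬ Q i) → count (λ i → P? i ⊎-dec Q? i) ≡ count P? + count Q?
  count-⊎ disjoint = trans (sum-cong-≗ {n} (λ i → 𝟙-⊎ (P? i) (Q? i) (disjoint i))) (∑-distrib-+ {n} _ _)

count-cong : ∀ {n} {P Q : Fin n → Set} (P? : ∀ i → Dec (P i)) (Q? : ∀ i → Dec (Q i)) →
             (∀ i → P i → Q i) → (∀ i → Q i → P i) → count P? ≡ count Q?
count-cong P? Q? P⊆Q Q⊆P = ≤-antisym (count-mono P? Q? P⊆Q) (count-mono Q? P? Q⊆P)

count-¬ : ∀ {n} {P : Fin n → Set} (P? : ∀ i → Dec (P i)) → count P? + count (¬? ∘ P?) ≡ n
count-¬ {n} P? = begin
  count P? + count (¬? ∘ P?)            ≡⟨ ∑-distrib-+ {n} _ _ ⟨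
  sum (λ i → 𝟙 (P? i) + 𝟙 (¬? (P? i))) ≡⟨ sum-cong-≗ {n} (𝟙-¬ ∘ P?) ⟩
  sum {n} (λ _ → 1)                     ≡⟨ sum-const n 1 ⟩
  n * 1                                 ≡⟨ *-identityʳ n ⟩
  n                                     ∎
  where open ≡-Reasoning

count-universal : ∀ {n} {P : Fin n → Set} (P? : ∀ i → Dec (P i)) → (∀ i → P i) → count P? ≡ n
count-universal {zero}  P? _ = refl
count-universal {suc n} P? all with P? zero
... | yes _ = cong suc (count-universal (P? ∘ suc) (all ∘ suc))
... | no ¬p = contradiction (all zero) ¬p

count-empty : ∀ {n} {P : Fin n → Set} (P? : ∀ i → Dec (P i)) → (∀ i → ¬ P i) → count P? ≡ 0
count-empty {zero}  P? _    = refl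
count-empty {suc n} P? none with P? zero
... | yes p = contradiction p (none zero)
... | no _  = count-empty (P? ∘ suc) (none ∘ suc)

count≡𝟙-any : ∀ {n} {P : Fin n → Set} (P? : ∀ i → Dec (P i)) →
              (∀ {i j} → P i → P j → i ≡ j) → count P? ≡ 𝟙 (any? P?)
count≡𝟙-any {zero}  P? unique = refl
count≡𝟙-any {suc n} P? unique with P? zero
... | yes p = cong suc (count-empty (P? ∘ suc) (λ _ q → 0≢1+n (unique p q)))
... | no _  = count≡𝟙-any (P? ∘ suc) (λ p q → suc-injective (unique p q))

count-≢ : ∀ {n} (i : Fin (suc n)) → count (λ j → ¬? (i ≟ j)) ≡ n
count-≢ {n} i = ℕ.suc-injective (begin
  suc (count (λ j → ¬? (i ≟ j)))          ≡⟨ cong (_+ count (λ j → ¬? (i ≟ j))) #i ⟨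
  count (i ≟_) + count (λ j → ¬? (i ≟ j)) ≡⟨ count-¬ (i ≟_) ⟩
  suc n                                    ∎)
  where
  open ≡-Reasoning
  #i : count (i ≟_) ≡ 1
  #i = trans (count≡𝟙-any (i ≟_) (λ e e′ → trans (sym e) e′)) (𝟙-yes (any? (i ≟_)) (i , refl))

count-∃-comm : ∀ {m n} {R : Fin m → Fin n → Set} (R? : ∀ x y → Dec (R x y)) →
               (∀ {x y y′} → R x y → R x y′ → y ≡ y′) →
               (∀ {x x′ y} → R x y → R x′ y → x ≡ x′) →
               count (λ x → any? (R? x)) ≡ count (λ y → any? (λ x → R? x y))
count-∃-comm {m} {n} R? functional injective = begin
  sum (λ x → 𝟙 (any? (R? x)))         ≡⟨ sum-cong-≗ {m} (λ x → count≡𝟙-any (R? x) functional) ⟨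
  sum (λ x → sum (λ y → 𝟙 (R? x y)))  ≡⟨ ∑-comm (λ x y → 𝟙 (R? x y)) ⟩
  sum (λ y → sum (λ x → 𝟙 (R? x y)))  ≡⟨ sum-cong-≗ {n} (λ y → count≡𝟙-any (λ x → R? x y) injective) ⟩
  sum (λ y → 𝟙 (any? (λ x → R? x y))) ∎
  where open ≡-Reasoning

module _ {m n} {Q : Fin n → Set} (Q? : ∀ q → Dec (Q q))
         {h : Fin m → Fin n} (h-injective : Injective _≡_ _≡_ h) where

  private
    Hit? : ∀ q → Dec (∃ λ l → h l ≡ q × Q q)
    Hit? q = any? (λ l → h l ≟ q ×-dec Q? q)

    hit⇒Q : ∀ q → (∃ λ l → h l ≡ q × Q q) → Q q
    hit⇒Q _ (_ , _ , Qq) = Qq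

    count-∘≡count-hit : count (Q? ∘ h) ≡ count Hit?
    count-∘≡count-hit = trans
      (count-cong (Q? ∘ h) (λ l → any? (λ q → h l ≟ q ×-dec Q? q))
        (λ l Qhl → h l , refl , Qhl) (λ { l (_ , refl , Qhl) → Qhl }))
      (count-∃-comm (λ l q → h l ≟ q ×-dec Q? q)
        (λ (e , _) (e′ , _) → trans (sym e) e′) (λ (e , _) (e′ , _) → h-injective (trans e (sym e′))))

  count-∘-injective : count (Q? ∘ h) ≤ count Q?
  count-∘-injective = ≤-trans (≤-reflexive count-∘≡count-hit) (count-mono Hit? Q? hit⇒Q)

  count-∘-injective-onto : count Q? ≤ count (Q? ∘ h) → ∀ q → Q q → ∃ λ l → h l ≡ q
  count-∘-injective-onto #Q≤ q Qq =
    let l , e , _ = count-mono-tight Hit? Q? hit⇒Q (≤-trans #Q≤ (≤-reflexive count-∘≡count-hit)) q Qq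
    in l , e

module _ {n : ℕ} {P : Fin (suc n) → Set} {k : ℕ} where

  Exactly-cons : P zero → Exactly k (P ∘ suc) → Exactly (suc k) P
  Exactly-cons P₀ (f , f-injective , f-sound , f-complete) = F , F-injective , F-sound , F-complete
    where
    F : Fin (suc k) → Fin (suc n)
    F zero    = zero
    F (suc t) = suc (f t)
    F-injective : Injective _≡_ _≡_ F
    F-injective {zero}  {zero}  _ = refl
    F-injective {suc _} {suc _} e = cong suc (f-injective (suc-injective e))
    F-sound : ∀ t → P (F t)
    F-sound zero    = P₀
    F-sound (suc t) = f-sound t
    F-complete : ∀ i → P i → ∃ λ t → F t ≡ i
    F-complete zero    _  = zero , refl
    F-complete (suc i) Pi = let t , e = f-complete i Pi in suc t , cong suc e

  Exactly-skip : ¬ P zero → Exactly k (P ∘ suc) → Exactly k P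
  Exactly-skip ¬P₀ (f , f-injective , f-sound , f-complete) =
    suc ∘ f , f-injective ∘ suc-injective , f-sound , complete
    where
    complete : ∀ i → P i → ∃ λ t → suc (f t) ≡ i
    complete zero    P₀ = contradiction P₀ ¬P₀
    complete (suc i) Pi = let t , e = f-complete i Pi in t , cong suc e

enumerate : ∀ {n} {P : Fin n → Set} (P? : ∀ i → Dec (P i)) → Exactly (count P?) P
enumerate {zero}  P? = (λ ()) , (λ { {()} }) , (λ ()) , (λ ())
enumerate {suc n} {P} P? = cons (P? zero)
  where
  cons : (p : Dec (P zero)) → Exactly (𝟙 p + count (P? ∘ suc)) P
  cons (yes P₀) = Exactly-cons P₀ (enumerate (P? ∘ suc))
  cons (no ¬P₀) = Exactly-skip ¬P₀ (enumerate (P? ∘ suc))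

Exactly⇒AtLeast : ∀ {A : Set} {P : A → Set} {k} → Exactly k P → AtLeast k P
Exactly⇒AtLeast (f , f-injective , f-sound , _) = f , f-injective , f-sound

AtLeast-∷ : ∀ {A : Set} {P Q : A → Set} {k x} →
            (∀ a → P a → Q a) → Q x → ¬ P x → AtLeast k P → AtLeast (suc k) Q
AtLeast-∷ {A} {P} {Q} {k} {x} P⊆Q Qx ¬Px (f , f-injective , f-sound) = F , F-injective , F-sound
  where
  F : Fin (suc k) → A
  F zero    = x
  F (suc t) = f t
  F-injective : Injective _≡_ _≡_ F
  F-injective {zero}  {zero}  _ = refl
  F-injective {zero}  {suc t} e = contradiction (subst P (sym e) (f-sound t)) ¬Px
  F-injective {suc t} {zero}  e = contradiction (subst P e (f-sound t)) ¬Px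
  F-injective {suc _} {suc _} e = cong suc (f-injective e)
  F-sound : ∀ t → Q (F t)
  F-sound zero    = Qx
  F-sound (suc t) = P⊆Q (f t) (f-sound t)

Exactly-map : ∀ {A B : Set} {P : B → Set} {Q : A → Set} {k} (g : ∀ {b} → P b → A) →
              (∀ {b} (p : P b) → Q (g p)) →
              (∀ {b b′} (p : P b) (p′ : P b′) → g p ≡ g p′ → b ≡ b′) →
              (∀ {b} (p p′ : P b) → g p ≡ g p′) →
              (∀ a → Q a → ∃ λ b → Σ (P b) λ p → g p ≡ a) →
              Exactly k P → Exactly k Q
Exactly-map {Q = Q} g g-sound g-injective g-irrelevant g-onto (f , f-injective , f-sound , f-complete) =
  g ∘ f-sound , f-injective ∘ g-injective _ _ , g-sound ∘ f-sound , complete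
  where
  complete : ∀ a → Q a → ∃ λ t → g (f-sound t) ≡ a
  complete a Qa with b , p , refl ← g-onto a Qa with t , refl ← f-complete b p =
    t , g-irrelevant (f-sound t) p

module RegularTournament
  (m : ℕ) {R : Fin (suc (m + m)) → Fin (suc (m + m)) → Set} (R? : ∀ i j → Dec (R i j))
  (asym : ∀ {i j} → R i j → ¬ R j i) (outdegree≥ : ∀ i → m ≤ count (R? i)) where

  n : ℕ
  n = suc (m + m)

  outdegree indegree : Fin n → ℕ
  outdegree i = count (R? i)
  indegree  j = count (λ i → R? i j)

  private
    Distinct? : ∀ (i j : Fin n) → Dec (i ≢ j)
    Distinct? i j = ¬? (i ≟ j)

    Linked? : ∀ i j → Dec (R i j ⊎ R j i)
    Linked? i j = R? i j ⊎-dec R? j i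

    linked⇒≢ : ∀ {i j} → R i j ⊎ R j i → i ≢ j
    linked⇒≢ (inj₁ Rij) refl = asym Rij Rij
    linked⇒≢ (inj₂ Rji) refl = asym Rji Rji

    count-linked : ∀ i → count (Linked? i) ≡ outdegree i + indegree i
    count-linked i = count-⊎ (R? i) (λ j → R? j i) (λ _ → asym)

    count-linked≤ : ∀ i → count (Linked? i) ≤ count (Distinct? i)
    count-linked≤ i = count-mono (Linked? i) (Distinct? i) (λ _ → linked⇒≢)

    sum-linked : sum (λ i → count (Linked? i)) ≡ sum outdegree + sum outdegree
    sum-linked = begin
      sum (λ i → count (Linked? i))         ≡⟨ sum-cong-≗ {n} count-linked ⟩
      sum (λ i → outdegree i + indegree i)  ≡⟨ ∑-distrib-+ {n} outdegree indegree ⟩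
      sum outdegree + sum indegree          ≡⟨ cong (sum outdegree +_) (∑-comm (λ j i → 𝟙 (R? i j))) ⟩
      sum outdegree + sum outdegree         ∎
      where open ≡-Reasoning

    sum-distinct : sum (λ i → count (Distinct? i)) ≡ n * m + n * m
    sum-distinct = begin
      sum (λ i → count (Distinct? i))  ≡⟨ sum-cong-≗ {n} count-≢ ⟩
      sum {n} (λ _ → m + m)            ≡⟨ sum-const n (m + m) ⟩
      n * (m + m)                      ≡⟨ *-distribˡ-+ n m m ⟩
      n * m + n * m                    ∎
      where open ≡-Reasoning

    sum-outdegree≥ : n * m ≤ sum outdegree
    sum-outdegree≥ = ≤-trans (≤-reflexive (sym (sum-const n m))) (sum-mono-≤ outdegree≥)

    count-linked≡ : ∀ i → count (Linked? i) ≡ count (Distinct? i)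
    count-linked≡ = sum-mono-≤-tight count-linked≤ (begin
      sum (λ i → count (Distinct? i))  ≡⟨ sum-distinct ⟩
      n * m + n * m                    ≤⟨ +-mono-≤ sum-outdegree≥ sum-outdegree≥ ⟩
      sum outdegree + sum outdegree    ≡⟨ sum-linked ⟨
      sum (λ i → count (Linked? i))    ∎)
      where open ≤-Reasoning

    sum-outdegree≤ : sum outdegree ≤ n * m
    sum-outdegree≤ = +-cancel-double-≤ (begin
      sum outdegree + sum outdegree    ≡⟨ sum-linked ⟨
      sum (λ i → count (Linked? i))    ≤⟨ sum-mono-≤ count-linked≤ ⟩
      sum (λ i → count (Distinct? i))  ≡⟨ sum-distinct ⟩
      n * m + n * m                    ∎)
      where open ≤-Reasoning

  total : ∀ i j → i ≢ j → R i j ⊎ R j i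
  total i = count-mono-tight (Linked? i) (Distinct? i) (λ _ → linked⇒≢)
    (≤-reflexive (sym (count-linked≡ i)))

  outdegree≡ : ∀ i → outdegree i ≡ m
  outdegree≡ i =
    sym (sum-mono-≤-tight outdegree≥ (≤-trans sum-outdegree≤ (≤-reflexive (sym (sum-const n m)))) i)

  indegree≡ : ∀ j → indegree j ≡ m
  indegree≡ j = +-cancelˡ-≡ m _ _ (begin
    m + indegree j                ≡⟨ cong (_+ indegree j) (outdegree≡ j) ⟨
    outdegree j + indegree j      ≡⟨ count-linked j ⟨
    count (Linked? j)             ≡⟨ count-linked≡ j ⟩
    count (Distinct? j)           ≡⟨ count-≢ j ⟩
    m + m                         ∎)
    where open ≡-Reasoning

module TreeColouring {n k : ℕ} (c : TEdge n → Fin k) (star : IsStarEdgeColoring (T n) c) where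

  rootColour : Fin n → Fin k
  rootColour i = c (top i)

  leafColour : Fin n → Fin (n ∸ 1) → Fin k
  leafColour i l = c (bot i l)

  private
    proper : IsProperEdgeColoring (T n) c
    proper = proj₁ star

  rootColour-injective : Injective _≡_ _≡_ rootColour
  rootColour-injective {i} {j} e = decidable-stable (i ≟ j)
    (λ i≢j → proper root (top i) (top j) (λ { refl → i≢j refl }) (inj₁ refl) (inj₁ refl) e)

  leafColour-injective : ∀ i → Injective _≡_ _≡_ (leafColour i)
  leafColour-injective i {l} {l′} e = decidable-stable (l ≟ l′)
    (λ l≢l′ → proper (mid i) (bot i l) (bot i l′) (λ { refl → l≢l′ refl }) (inj₁ refl) (inj₁ refl) e)

  leafColour≢rootColour : ∀ i l → leafColour i l ≢ rootColour i
  leafColour≢rootColour i l = proper (mid i) (bot i l) (top i) (λ ()) (inj₁ refl) (inj₂ refl)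

  no-bicoloured-leaf-path : ∀ {i j l l′} → i ≢ j →
                            leafColour i l ≡ rootColour j → leafColour j l′ ≡ rootColour i → ⊥
  no-bicoloured-leaf-path {i} {j} {l} {l′} i≢j eᵢ eⱼ = proj₂ star path (inj₁ distinct)
    (rootColour j , rootColour i , inj₁ eᵢ , inj₂ refl , inj₁ refl , inj₂ eⱼ)
    where
    path : Walk4 (T n)
    path = record
      { v₀ = leaf i l ; v₁ = mid i ; v₂ = root ; v₃ = mid j ; v₄ = leaf j l′
      ; e₁ = bot i l  ; e₂ = top i ; e₃ = top j ; e₄ = bot j l′
      ; j₁ = inj₂ (refl , refl) ; j₂ = inj₂ (refl , refl)
      ; j₃ = inj₁ (refl , refl) ; j₄ = inj₁ (refl , refl) }
    distinct : IsPath4 (T n) path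
    distinct = ((λ ()) ∷ (λ ()) ∷ (λ ()) ∷ (λ { refl → i≢j refl }) ∷ [])
             ∷ ((λ ()) ∷ (λ { refl → i≢j refl }) ∷ (λ ()) ∷ [])
             ∷ ((λ ()) ∷ (λ ()) ∷ [])
             ∷ ((λ ()) ∷ [])
             ∷ [] ∷ []

  _⇝_ : Fin n → Fin n → Set
  i ⇝ j = ∃ λ l → leafColour i l ≡ rootColour j

  _⇝?_ : ∀ i j → Dec (i ⇝ j)
  i ⇝? j = any? (λ l → leafColour i l ≟ rootColour j)

  ⇝-asym : ∀ {i j} → i ⇝ j → ¬ j ⇝ i
  ⇝-asym {i} {j} (l , eᵢ) (_ , eⱼ) with i ≟ j
  ... | yes refl = leafColour≢rootColour i l eᵢ
  ... | no i≢j   = no-bicoloured-leaf-path i≢j eᵢ eⱼ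

  RootColour : Fin k → Set
  RootColour col = ∃ λ j → col ≡ rootColour j

  RootColour? : ∀ col → Dec (RootColour col)
  RootColour? col = any? (λ j → col ≟ rootColour j)

  count-RootColour : count RootColour? ≡ n
  count-RootColour = trans
    (count-∃-comm (λ col j → col ≟ rootColour j)
      (λ e e′ → rootColour-injective (trans (sym e) e′)) (λ e e′ → trans e (sym e′)))
    (count-universal (λ j → any? (λ col → col ≟ rootColour j)) (λ j → rootColour j , refl))

  count-RootColour∘leafColour : ∀ i → count (RootColour? ∘ leafColour i) ≡ count (i ⇝?_)
  count-RootColour∘leafColour i = count-∃-comm (λ l j → leafColour i l ≟ rootColour j)
    (λ e e′ → rootColour-injective (trans (sym e) e′))
    (λ e e′ → leafColour-injective i (trans e (sym e′)))

module OddStarColouring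
  (m : ℕ) {k : ℕ} (c : TEdge (suc (m + m)) → Fin k)
  (k≤ : k ≤ suc (m + m) + m) (star : IsStarEdgeColoring (T (suc (m + m))) c) where

  open TreeColouring c star

  n : ℕ
  n = suc (m + m)

  NonRoot? : ∀ col → Dec (¬ RootColour col)
  NonRoot? = ¬? ∘ RootColour?

  count-NonRoot≤ : count NonRoot? ≤ m
  count-NonRoot≤ = +-cancelˡ-≤ n _ _ (begin
    n + count NonRoot?                  ≡⟨ cong (_+ count NonRoot?) count-RootColour ⟨
    count RootColour? + count NonRoot?  ≡⟨ count-¬ RootColour? ⟩
    k                                   ≤⟨ k≤ ⟩
    n + m                               ∎)
    where open ≤-Reasoning

  count-leaves : ∀ i → count (i ⇝?_) + count (NonRoot? ∘ leafColour i) ≡ m + m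
  count-leaves i =
    trans (cong (_+ count (NonRoot? ∘ leafColour i)) (sym (count-RootColour∘leafColour i)))
          (count-¬ (RootColour? ∘ leafColour i))

  count-NonRoot∘leafColour≤ : ∀ i → count (NonRoot? ∘ leafColour i) ≤ m
  count-NonRoot∘leafColour≤ i =
    ≤-trans (count-∘-injective NonRoot? (leafColour-injective i)) count-NonRoot≤

  outdegree≥ : ∀ i → m ≤ count (i ⇝?_)
  outdegree≥ i = +-cancelʳ-≤ m m (count (i ⇝?_)) (begin
    m + m                                            ≡⟨ count-leaves i ⟨
    count (i ⇝?_) + count (NonRoot? ∘ leafColour i)  ≤⟨ +-monoʳ-≤ _ (count-NonRoot∘leafColour≤ i) ⟩
    count (i ⇝?_) + m                                ∎)
    where open ≤-Reasoning

  open RegularTournament m _⇝?_ ⇝-asym outdegree≥ using (total; outdegree≡; indegree≡)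

  count-NonRoot∘leafColour≡ : ∀ i → count (NonRoot? ∘ leafColour i) ≡ m
  count-NonRoot∘leafColour≡ i = +-cancelˡ-≡ m _ _
    (trans (cong (_+ count (NonRoot? ∘ leafColour i)) (sym (outdegree≡ i))) (count-leaves i))

  count-NonRoot≡ : count NonRoot? ≡ m
  count-NonRoot≡ = ≤-antisym count-NonRoot≤ (subst (_≤ count NonRoot?) (count-NonRoot∘leafColour≡ zero)
    (count-∘-injective NonRoot? (leafColour-injective zero)))

  nonRoot-at-leaves : ∀ i col → ¬ RootColour col → ∃ λ l → leafColour i l ≡ col
  nonRoot-at-leaves i = count-∘-injective-onto NonRoot? (leafColour-injective i)
    (≤-trans count-NonRoot≤ (≤-reflexive (sym (count-NonRoot∘leafColour≡ i))))

  C : TVtx n → Fin k → Set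
  C v col = _∈C_ (T n) {c = c} col v

  C-root⇒RootColour : ∀ {col} → C root col → RootColour col
  C-root⇒RootColour (top j   , inj₁ refl , e) = j , sym e
  C-root⇒RootColour (top _   , inj₂ ()   , _)
  C-root⇒RootColour (bot _ _ , inj₁ ()   , _)
  C-root⇒RootColour (bot _ _ , inj₂ ()   , _)

  RootColour⇒C-root : ∀ {col} → RootColour col → C root col
  RootColour⇒C-root (j , e) = top j , inj₁ refl , sym e

  nonRoot∈C-mid : ∀ i col → ¬ RootColour col → C (mid i) col
  nonRoot∈C-mid i col ¬r = let l , e = nonRoot-at-leaves i col ¬r in bot i l , inj₁ refl , e

  shared-root-colour : ∀ {i j} → i ⇝ j ⊎ j ⇝ i →
                       ∃ λ col → RootColour col × C (mid i) col × C (mid j) col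
  shared-root-colour {i} {j} (inj₁ (l , e)) =
    rootColour j , (j , refl) , (bot i l , inj₁ refl , e) , (top j , inj₂ refl , refl)
  shared-root-colour {i} {j} (inj₂ (l , e)) =
    rootColour i , (i , refl) , (top i , inj₂ refl , refl) , (bot j l , inj₁ refl , e)

  common-colours : ∀ i j → i ≢ j → AtLeast (suc m) (λ col → C (mid i) col × C (mid j) col)
  common-colours i j i≢j = extend (shared-root-colour (total i j i≢j))
    where
    extend : (∃ λ col → RootColour col × C (mid i) col × C (mid j) col) →
             AtLeast (suc m) (λ col → C (mid i) col × C (mid j) col)
    extend (_ , r , Ci , Cj) =
      AtLeast-∷ (λ col ¬r → nonRoot∈C-mid i col ¬r , nonRoot∈C-mid j col ¬r) (Ci , Cj) (λ ¬r → ¬r r)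
        (Exactly⇒AtLeast (subst (λ s → Exactly s (λ col → ¬ RootColour col)) count-NonRoot≡
          (enumerate NonRoot?)))

  root-colour-multiplicity : ∀ {col} → C root col →
                             Exactly m (λ e → ¬ Incident (T n) root e × c e ≡ col)
  root-colour-multiplicity Cv with j , refl ← C-root⇒RootColour Cv =
    Exactly-map (λ {i} (l , _) → bot i l) (λ (_ , e) → (λ { (inj₁ ()) ; (inj₂ ()) }) , e)
      (λ { _ _ refl → refl })
      (λ {i} (_ , e) (_ , e′) → cong (bot i) (leafColour-injective i (trans e (sym e′))))
      onto (subst (λ s → Exactly s (_⇝ j)) (indegree≡ j) (enumerate (_⇝? j)))
    where
    onto : ∀ e → ¬ Incident (T n) root e × c e ≡ rootColour j →
           ∃ λ i → Σ (i ⇝ j) λ p → bot i (proj₁ p) ≡ e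
    onto (top i)   (¬v , _) = contradiction (inj₁ refl) ¬v
    onto (bot i l) (_ , e)  = i , (l , e) , refl

  joins-root : ∀ {e i} → Joins (T n) e root (mid i) → e ≡ top i
  joins-root {top _}   (inj₁ (refl , refl)) = refl
  joins-root {top _}   (inj₂ (() , _))
  joins-root {bot _ _} (inj₁ (() , _))
  joins-root {bot _ _} (inj₂ (_ , ()))

  root-colour-repeated : ∀ {i j} → i ⇝ j ⊎ j ⇝ i → C (mid j) (rootColour i) ⊎ C (mid i) (rootColour j)
  root-colour-repeated {i}     (inj₁ (l , e)) = inj₂ (bot i l , inj₁ refl , e)
  root-colour-repeated {j = j} (inj₂ (l , e)) = inj₁ (bot j l , inj₁ refl , e)

  root-edge-colour-repeated : ∀ i j → i ≢ j → ∀ ex ey →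
                              Joins (T n) ex root (mid i) → Joins (T n) ey root (mid j) →
                              C (mid j) (c ex) ⊎ C (mid i) (c ey)
  root-edge-colour-repeated i j i≢j ex ey vxᵢ vxⱼ rewrite joins-root vxᵢ | joins-root vxⱼ =
    root-colour-repeated (total i j i≢j)

adjacent-root : ∀ {Δ} {x : TVtx Δ} → Adjacent (T Δ) root x → ∃ λ i → x ≡ mid i
adjacent-root (top i   , inj₁ (refl , refl)) = i , refl
adjacent-root (top _   , inj₂ (refl , ()))
adjacent-root (bot _ _ , inj₁ (() , _))
adjacent-root (bot _ _ , inj₂ (_ , ()))

*2≡+ : ∀ m → m * 2 ≡ m + m
*2≡+ m = trans (*-comm m 2) (cong (m +_) (+-identityʳ m))

odd⇒suc-double : ∀ Δ → Δ % 2 ≡ 1 → ∃ λ m → Δ ≡ suc (m + m)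
odd⇒suc-double Δ odd = Δ / 2 , trans (m≡m%n+[m/n]*n Δ 2) (cong₂ _+_ odd (*2≡+ (Δ / 2)))

[m+m]/2≡m : ∀ m → (m + m) / 2 ≡ m
[m+m]/2≡m m = trans (cong (_/ 2) (sym (*2≡+ m))) (m*n/n≡m m 2)

[1+m*2]/2≡m : ∀ m → suc (m * 2) / 2 ≡ m
[1+m*2]/2≡m m = trans (+-distrib-/ 1 (m * 2) (subst (λ r → 1 + r < 2) (sym (m*n%n≡0 m 2)) ≤-refl))
                      (m*n/n≡m m 2)

[1+2m+1]/2≡1+m : ∀ m → (suc (m + m) + 1) / 2 ≡ suc m
[1+2m+1]/2≡1+m m =
  trans (cong (_/ 2) (trans (+-comm (suc (m + m)) 1) (cong suc (sym (+-suc m m))))) ([m+m]/2≡m (suc m))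

3*[1+2m]≡1+[1+3m]*2 : ∀ m → 3 * suc (m + m) ≡ suc ((suc (m + m) + m) * 2)
3*[1+2m]≡1+[1+3m]*2 = solve-∀

3*[1+2m]/2≡1+3m : ∀ m → (3 * suc (m + m)) / 2 ≡ suc (m + m) + m
3*[1+2m]/2≡1+3m m = trans (cong (_/ 2) (3*[1+2m]≡1+[1+3m]*2 m)) ([1+m*2]/2≡m (suc (m + m) + m))

mainTheorem3 :
    (Δ : ℕ) → Δ % 2 ≡ 1 → 1 < Δ →
    (c : TEdge Δ → Fin ((3 * Δ) / 2)) →
    IsStarEdgeColoring (T Δ) c →
    (x y : TVtx Δ) → x ≢ y →
    Adjacent (T Δ) root x → Adjacent (T Δ) root y →
      -- (a)
      (AtLeast ((Δ + 1) / 2)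
         (λ col → _∈C_ (T Δ) {c = c} col x × _∈C_ (T Δ) {c = c} col y)
       × (∀ col → ¬ _∈C_ (T Δ) {c = c} col root → _∈C_ (T Δ) {c = c} col x))
      -- (b)
      × (∀ col → _∈C_ (T Δ) {c = c} col root →
           Exactly ((Δ ∸ 1) / 2)
             (λ e → ¬ Incident (T Δ) root e × c e ≡ col))
      -- (c)
      × (∀ ex ey → Joins (T Δ) ex root x → Joins (T Δ) ey root y →
           _∈C_ (T Δ) {c = c} (c ex) y ⊎ _∈C_ (T Δ) {c = c} (c ey) x)
mainTheorem3 Δ odd _ c star x y x≢y vx vy
  with m , refl ← odd⇒suc-double Δ odd
  with i , refl ← adjacent-root vx | j , refl ← adjacent-root vy =
  ( subst (λ s → AtLeast s (λ col → C (mid i) col × C (mid j) col)) (sym ([1+2m+1]/2≡1+m m))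
      (common-colours i j i≢j)
  , λ col ¬Cv → nonRoot∈C-mid i col (¬Cv ∘ RootColour⇒C-root) )
  , (λ col Cv → subst (λ s → Exactly s (λ e → ¬ Incident (T n) root e × c e ≡ col)) (sym ([m+m]/2≡m m))
      (root-colour-multiplicity Cv))
  , root-edge-colour-repeated i j i≢j
  where
  open OddStarColouring m c (≤-reflexive (3*[1+2m]/2≡1+3m m)) star
  i≢j : i ≢ j
  i≢j = x≢y ∘ cong mid
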